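{- Let $F$ be a finite forest containing an isolated edge $uv$ (a connected component consisting of the two vertices $u,v$ and the edge $uv$). Then $o(F)=o(F\setminus\{u,v\})$.
   Context: Maker-Maker domination game on a finite simple graph $G$: Alice and Bob alternately claim previously unclaimed vertices, Alice first; the first player whose claimed vertices form a dominating set of $G$ wins; if all vertices are claimed and nobody dominates, it is a draw. $o(G)=\mathcal{A}$ if Alice has a winning strategy and $o(G)=\mathcal{D}$ otherwise. -}

module Defs where

open import Data.Nat using (ℕ; zero; suc; _≤_)
open import Data.Fin using (Fin; punchIn; punchOut)
open import Data.Fin.Properties using (_≟_)
open import Data.Bool using (Bool; true; false)
open import Data.List using (List; []; _∷_; _++_; [_]; length)
open import Data.List.Relation.Unary.Unique.Propositional using (Unique)
open import Data.Product using (Σ; ∃; ∃-syntax; _×_; _,_)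
open import Data.Sum using (_⊎_)
open import Relation.Nullary using (¬_; yes; no)
open import Relation.Binary.PropositionalEquality using (_≡_; _≢_; refl; subst)
open import Data.Unit using (⊤)

record Graph (n : ℕ) : Set where
  field
    Adj   : Fin n → Fin n → Bool
    sym   : ∀ x y → Adj x y ≡ Adj y x
    irref : ∀ x → Adj x x ≡ false
open Graph public

module _ {n : ℕ} (G : Graph n) where

  Chain : List (Fin n) → Set
  Chain []           = ⊤
  Chain (x ∷ [])     = ⊤
  Chain (x ∷ y ∷ r)  = (Adj G x y ≡ true) × Chain (y ∷ r)

  HasCycle : Set
  HasCycle = Σ (Fin n) λ x → Σ (List (Fin n)) λ ys →
               (2 ≤ length ys) × Unique (x ∷ ys) × Chain (x ∷ ys ++ [ x ])

  IsForest : Set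
  IsForest = ¬ HasCycle

  IsolatedEdge : Fin n → Fin n → Set
  IsolatedEdge u v = (Adj G u v ≡ true)
                   × (∀ w → Adj G u w ≡ true → w ≡ v)
                   × (∀ w → Adj G v w ≡ true → w ≡ u)

deleteVertex : ∀ {n} → Graph (suc n) → Fin (suc n) → Graph n
deleteVertex G u = record
  { Adj   = λ i j → Adj G (punchIn u i) (punchIn u j)
  ; sym   = λ i j → sym G (punchIn u i) (punchIn u j)
  ; irref = λ i → irref G (punchIn u i) }

adj⇒≢ : ∀ {n} (G : Graph n) {u v} → Adj G u v ≡ true → u ≢ v
adj⇒≢ G {u} e refl with subst (_≡ true) (irref G u) e
... | ()

delete2 : ∀ {n} → Graph (suc (suc n)) → (u v : Fin (suc (suc n))) → u ≢ v → Graph n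
delete2 G u v u≢v = deleteVertex (deleteVertex G u) (punchOut u≢v)

data Cell : Set where
  free alice bob : Cell

Position : ℕ → Set
Position n = Fin n → Cell

start : ∀ {n} → Position n
start _ = free

_[_↦_] : ∀ {n} → Position n → Fin n → Cell → Position n
(s [ v ↦ c ]) w with w ≟ v
... | yes _ = c
... | no  _ = s w

module _ {n : ℕ} (G : Graph n) where

  Dominates : Position n → Cell → Set
  Dominates s c = ∀ x → (s x ≡ c) ⊎ (∃[ y ] (s y ≡ c × Adj G y x ≡ true))

  data AliceWinsFrom (s : Position n) : Set where
    move : (v : Fin n) → s v ≡ free →
           Dominates (s [ v ↦ alice ]) alice
           ⊎ ( (∃[ w ] ((s [ v ↦ alice ]) w ≡ free))
             × (∀ w → (s [ v ↦ alice ]) w ≡ free →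
                  ¬ Dominates ((s [ v ↦ alice ]) [ w ↦ bob ]) bob
                  × AliceWinsFrom ((s [ v ↦ alice ]) [ w ↦ bob ])) ) →
           AliceWinsFrom s

  -- o(G) = 𝒜 : the empty claimed set of Alice already dominates (only for
  -- the graph with no vertices), or Alice wins from the initial position
  OutcomeA : Set
  OutcomeA = Dominates start alice ⊎ AliceWinsFrom start

-- Every dominating set of F contains u or v, so F ∖ {u,v} is played as before
-- while the isolated edge works as a pairing: whoever claims one end is answered
-- on the other. A winning strategy for Alice on F ∖ {u,v} lifts to F, answering
-- Bob's move on an end by the other end, and winning with a free end once she
-- dominates the rest. Conversely, a winning strategy on F restricts: her moves
-- on the edge are answered on the edge and skipped, and whenever Bob dominates
-- the rest while the edge is free, Alice must already dominate it too, since
-- otherwise Bob wins by claiming an end.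
module Submission where

open import Defs hiding (sym)
open import Data.Nat using (ℕ; suc)
open import Data.Fin using (Fin; punchIn; punchOut)
open import Data.Fin.Properties using (_≟_; punchIn-punchOut; punchInᵢ≢i; punchIn-injective; all?; any?)
open import Data.Bool using (true)
open import Data.Bool.Properties using () renaming (_≟_ to _≟ᵇ_)
open import Data.Empty using (⊥-elim)
open import Data.Product using (proj₁; proj₂; _,_; _×_; ∃-syntax; ∃₂)
open import Data.Sum using (_⊎_; inj₁; inj₂)
open import Function using (_∘_)
open import Function.Bundles using (_⇔_; mk⇔)
open import Relation.Nullary using (¬_; Dec; yes; no)
open import Relation.Nullary.Decidable using (_⊎-dec_; _×-dec_)
open import Relation.Binary.PropositionalEquality
  using (_≡_; _≢_; _≗_; refl; sym; trans; cong; subst; ≢-sym)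

_≟ᶜ_ : (a b : Cell) → Dec (a ≡ b)
free  ≟ᶜ free  = yes refl
free  ≟ᶜ alice = no λ ()
free  ≟ᶜ bob   = no λ ()
alice ≟ᶜ free  = no λ ()
alice ≟ᶜ alice = yes refl
alice ≟ᶜ bob   = no λ ()
bob   ≟ᶜ free  = no λ ()
bob   ≟ᶜ alice = no λ ()
bob   ≟ᶜ bob   = yes refl

alice≢free : alice ≢ free
alice≢free ()

bob≢free : bob ≢ free
bob≢free ()

alice≢bob : alice ≢ bob
alice≢bob ()

module _ {m : ℕ} (s : Position m) where

  ↦-self : ∀ x c → (s [ x ↦ c ]) x ≡ c
  ↦-self x c with x ≟ x
  ... | yes _  = refl
  ... | no x≢x = ⊥-elim (x≢x refl)

  ↦-other : ∀ {x y} c → y ≢ x → (s [ x ↦ c ]) y ≡ s y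
  ↦-other {x} {y} c y≢x with y ≟ x
  ... | yes y≡x = ⊥-elim (y≢x y≡x)
  ... | no _    = refl

  ↦-keeps-claimed : ∀ {x y c d} → s x ≡ free → s y ≡ c → c ≢ free → (s [ x ↦ d ]) y ≡ c
  ↦-keeps-claimed {x} {y} fx sy c≢free with y ≟ x
  ... | yes refl = ⊥-elim (c≢free (trans (sym sy) fx))
  ... | no _     = sy

  ↦-reflects : ∀ {x y c d} → (s [ x ↦ d ]) y ≡ c → c ≢ d → s y ≡ c
  ↦-reflects {x} {y} sy c≢d with y ≟ x
  ... | yes _ = ⊥-elim (c≢d (sym sy))
  ... | no _  = sy

  ↦-fresh : ∀ {x y c d} → (s [ x ↦ d ]) y ≡ c → s y ≡ free → c ≢ free → y ≡ x
  ↦-fresh {x} {y} sy fy c≢free with y ≟ x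
  ... | yes y≡x = y≡x
  ... | no _    = ⊥-elim (c≢free (trans (sym sy) fy))

module _ {m : ℕ} (G : Graph m) where

  Dominates-mono : ∀ {a b c} → Dominates G a c → (∀ i → a i ≡ c → b i ≡ c) → Dominates G b c
  Dominates-mono d a⊆b x with d x
  ... | inj₁ ax            = inj₁ (a⊆b x ax)
  ... | inj₂ (y , ay , yx) = inj₂ (y , a⊆b y ay , yx)

  dominates? : ∀ s c → Dec (Dominates G s c)
  dominates? s c =
    all? λ x → (s x ≟ᶜ c) ⊎-dec any? (λ y → (s y ≟ᶜ c) ×-dec (Adj G y x ≟ᵇ true))

  ReplyLoses : Position m → Fin m → Set
  ReplyLoses t w = ¬ Dominates G (t [ w ↦ bob ]) bob × AliceWinsFrom G (t [ w ↦ bob ])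

  BobLoses : Position m → Set
  BobLoses t = (∃[ w ] t w ≡ free) × (∀ w → t w ≡ free → ReplyLoses t w)

module IsolatedEdgeGame (n : ℕ) (F : Graph (suc (suc n))) (u v : Fin (suc (suc n)))
                        (iso : IsolatedEdge F u v) where

  private
    N : ℕ
    N = suc (suc n)

  u≢v : u ≢ v
  u≢v = adj⇒≢ F (proj₁ iso)

  H : Graph n
  H = delete2 F u v u≢v

  private
    p : Fin (suc n)
    p = punchOut u≢v

  e : Fin n → Fin N
  e i = punchIn u (punchIn p i)

  e-injective : ∀ {i j} → e i ≡ e j → i ≡ j
  e-injective {i} {j} eq = punchIn-injective p i j (punchIn-injective u _ _ eq)

  e≢u : ∀ i → e i ≢ u
  e≢u i = punchInᵢ≢i u (punchIn p i)

  e≢v : ∀ i → e i ≢ v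
  e≢v i eq = punchInᵢ≢i p i (punchIn-injective u _ _ (trans eq (sym (punchIn-punchOut u≢v))))

  data Ends : Fin N → Fin N → Set where
    u-v : Ends u v
    v-u : Ends v u

  ends-swap : ∀ {x y} → Ends x y → Ends y x
  ends-swap u-v = v-u
  ends-swap v-u = u-v

  ends-cover : ∀ {x y z w} → Ends x y → Ends z w → z ≡ x ⊎ z ≡ y
  ends-cover u-v u-v = inj₁ refl
  ends-cover u-v v-u = inj₂ refl
  ends-cover v-u u-v = inj₂ refl
  ends-cover v-u v-u = inj₁ refl

  end≢partner : ∀ {x y} → Ends x y → x ≢ y
  end≢partner u-v = u≢v
  end≢partner v-u = ≢-sym u≢v

  e≢end : ∀ {x y} → Ends x y → ∀ i → e i ≢ x
  e≢end u-v = e≢u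
  e≢end v-u = e≢v

  end-adjacent : ∀ {x y} → Ends x y → Adj F x y ≡ true
  end-adjacent u-v = proj₁ iso
  end-adjacent v-u = trans (Graph.sym F v u) (proj₁ iso)

  end-neighbour : ∀ {x y z} → Ends x y → Adj F x z ≡ true → z ≡ y
  end-neighbour u-v = proj₁ (proj₂ iso) _
  end-neighbour v-u = proj₂ (proj₂ iso) _

  data View : Fin N → Set where
    end   : ∀ {x y} → Ends x y → View x
    inner : ∀ i → View (e i)

  view : ∀ x → View x
  view x with x ≟ u
  ... | yes refl = end u-v
  ... | no x≢u with x ≟ v
  ...   | yes refl = end v-u
  ...   | no x≢v   = subst View e[i]≡x (inner i)
    where
      u≢x : u ≢ x
      u≢x = ≢-sym x≢u
      p≢q : p ≢ punchOut u≢x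
      p≢q p≡q = x≢v (trans (sym (punchIn-punchOut u≢x))
                           (trans (cong (punchIn u) (sym p≡q)) (punchIn-punchOut u≢v)))
      i : Fin n
      i = punchOut p≢q
      e[i]≡x : e i ≡ x
      e[i]≡x = trans (cong (punchIn u) (punchIn-punchOut p≢q)) (punchIn-punchOut u≢x)

  infix 4 _↾_
  record _↾_ (s : Position N) (s' : Position n) : Set where
    constructor mk↾
    field at : s ∘ e ≗ s'
  open _↾_

  ↾-claim : ∀ {s s'} → s ↾ s' → ∀ i c → s [ e i ↦ c ] ↾ s' [ i ↦ c ]
  ↾-claim {s} {s'} s↾ i c = mk↾ claimed
    where
      claimed : ∀ j → (s [ e i ↦ c ]) (e j) ≡ (s' [ i ↦ c ]) j
      claimed j with j ≟ i
      ... | yes refl = ↦-self s (e j) c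
      ... | no j≢i   = trans (↦-other s c (j≢i ∘ e-injective)) (at s↾ j)

  ↾-claim-end : ∀ {s s' x y} c → Ends x y → s ↾ s' → s [ x ↦ c ] ↾ s'
  ↾-claim-end {s} c ε s↾ = mk↾ λ i → trans (↦-other s c (e≢end ε i)) (at s↾ i)

  ↾-keeps-claimed : ∀ {s s' x c} d → s ↾ s' → s x ≡ free → c ≢ free →
                    ∀ i → s' i ≡ c → (s [ x ↦ d ]) (e i) ≡ c
  ↾-keeps-claimed {s} {x = x} d s↾ sx c≢free i s'i =
    ↦-keeps-claimed s {x} {e i} {d = d} sx (trans (at s↾ i) s'i) c≢free

  restrict-dominates : ∀ {s s' c} → s ↾ s' → Dominates F s c → Dominates H s' c
  restrict-dominates s↾ d i with d (e i)
  ... | inj₁ si = inj₁ (trans (sym (at s↾ i)) si)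
  ... | inj₂ (y , sy , yi) with view y
  ...   | end ε   = ⊥-elim (e≢end (ends-swap ε) i (end-neighbour ε yi))
  ...   | inner j = inj₂ (j , trans (sym (at s↾ j)) sy , yi)

  extend-dominates : ∀ {s s' c x y} → s ↾ s' → Dominates H s' c → Ends x y → s x ≡ c →
                     Dominates F s c
  extend-dominates s↾ d ε sx z with view z
  ... | inner i with d i
  ...   | inj₁ si            = inj₁ (trans (at s↾ i) si)
  ...   | inj₂ (j , sj , ji) = inj₂ (e j , trans (at s↾ j) sj , ji)
  extend-dominates {x = x} s↾ d ε sx z | end ε′ with ends-cover ε ε′
  ...   | inj₁ refl = inj₁ sx
  ...   | inj₂ refl = inj₂ (x , sx , end-adjacent ε)

  dominates-end : ∀ {s c} → Dominates F s c → ∃₂ λ x y → Ends x y × s x ≡ c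
  dominates-end d with d u
  ... | inj₁ su            = u , v , u-v , su
  ... | inj₂ (y , sy , yu) with end-neighbour u-v (trans (Graph.sym F u y) yu)
  ...   | refl = v , u , v-u , sy

  record Unclaimed (s : Position N) : Set where
    constructor both-free
    field
      u-free : s u ≡ free
      v-free : s v ≡ free
  open Unclaimed

  unclaimed-end : ∀ {s x y} → Unclaimed s → Ends x y → s x ≡ free
  unclaimed-end unc u-v = u-free unc
  unclaimed-end unc v-u = v-free unc

  -- The invariant kept by both strategy transfers: the edge is either untouched
  -- or its ends are shared between the two players.
  data Paired (s : Position N) : Set where
    unclaimed : Unclaimed s → Paired s
    split     : ∀ {x y} → Ends x y → s x ≡ alice → s y ≡ bob → Paired s

  split-end-claimed : ∀ (s : Position N) {x y z w} → Ends x y → s x ≡ alice → s y ≡ bob →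
                      Ends z w → s z ≢ free
  split-end-claimed s ε sx sy ε′ sz with ends-cover ε ε′
  ... | inj₁ refl = alice≢free (trans (sym sx) sz)
  ... | inj₂ refl = bob≢free (trans (sym sy) sz)

  paired-free-end : ∀ {s x y} → Paired s → Ends x y → s x ≡ free → Unclaimed s
  paired-free-end         (unclaimed unc)  _  _  = unc
  paired-free-end {s} (split ε sx sy) ε′ sz = ⊥-elim (split-end-claimed s ε sx sy ε′ sz)

  paired-claim : ∀ {s} → Paired s → ∀ i c → Paired (s [ e i ↦ c ])
  paired-claim {s} (unclaimed unc) i c =
    unclaimed (both-free (trans (↦-other s c (≢-sym (e≢u i))) (u-free unc))
                         (trans (↦-other s c (≢-sym (e≢v i))) (v-free unc)))
  paired-claim {s} (split ε sx sy) i c =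
    split ε (trans (↦-other s c (≢-sym (e≢end ε i))) sx)
            (trans (↦-other s c (≢-sym (e≢end (ends-swap ε) i))) sy)

  claim-partner-keeps : ∀ (s : Position N) c d {x y} → Ends x y →
                        ((s [ x ↦ c ]) [ y ↦ d ]) x ≡ c
  claim-partner-keeps s c d {x} ε = trans (↦-other (s [ x ↦ c ]) d (end≢partner ε)) (↦-self s x c)

  partner-free : ∀ {s x y} c → Unclaimed s → Ends x y → (s [ x ↦ c ]) y ≡ free
  partner-free {s} c unc ε =
    trans (↦-other s c (≢-sym (end≢partner ε))) (unclaimed-end unc (ends-swap ε))

  claim-end-wins : ∀ {r r' x y} → r ↾ r' → Dominates H r' alice → Ends x y → r x ≡ free →
                   AliceWinsFrom F r
  claim-end-wins {r} {x = x} r↾ d ε rx =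
    move x rx (inj₁ (extend-dominates (↾-claim-end alice ε r↾) d ε (↦-self r x alice)))

  bob-claims-end : ∀ (s : Position N) {x y} → Dominates H (s ∘ e) bob → Ends x y →
                   Dominates F (s [ x ↦ bob ]) bob
  bob-claims-end s {x} d ε = extend-dominates (↾-claim-end bob ε (mk↾ λ _ → refl)) d ε (↦-self s x bob)

  -- On an untouched edge, Bob's dominating reply must take an end, leaving the rest unchanged.
  dominating-reply⇒dominated : ∀ {t t' w} → t ↾ t' → Unclaimed t → t w ≡ free →
                               Dominates F (t [ w ↦ bob ]) bob → Dominates H t' bob
  dominating-reply⇒dominated {t} t↾ unc tw d with dominates-end d
  ... | _ , _ , ε , q with ↦-fresh t q (unclaimed-end unc ε) bob≢free
  ...   | refl = restrict-dominates (↾-claim-end bob ε t↾) d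

  unclaimed-edge-wins : ∀ {t t'} → t ↾ t' → Unclaimed t → Dominates H t' alice →
                        ¬ Dominates H t' bob → BobLoses F t
  unclaimed-edge-wins {t} {t'} t↾ unc dA nB = (u , u-free unc) , reply
    where
      answer : ∀ {w} → View w → t w ≡ free → AliceWinsFrom F (t [ w ↦ bob ])
      answer (end ε) _ =
        claim-end-wins (↾-claim-end bob ε t↾) dA (ends-swap ε) (partner-free bob unc ε)
      answer (inner j) tj =
        claim-end-wins (↾-claim t↾ j bob) (Dominates-mono H dA kept) u-v
          (trans (↦-other t bob (≢-sym (e≢u j))) (u-free unc))
        where
          kept : ∀ i → t' i ≡ alice → (t' [ j ↦ bob ]) i ≡ alice
          kept i t'i = ↦-keeps-claimed t' (trans (sym (at t↾ j)) tj) t'i alice≢free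

      reply : ∀ w → t w ≡ free → ReplyLoses F t w
      reply w tw = (λ d → nB (dominating-reply⇒dominated t↾ unc tw d)) , answer (view w) tw

  -- If Bob dominates the rest while the edge is untouched, Alice's next move must
  -- win at once, or Bob wins by claiming an end.
  bob-threat : ∀ {r r'} → AliceWinsFrom F r → r ↾ r' → Unclaimed r → Dominates H r' bob →
               Dominates H r' alice
  bob-threat {r} (move x rx k) r↾ unc dB with view x | k
  ... | end ε   | inj₁ dA = restrict-dominates (↾-claim-end alice ε r↾) dA
  ... | inner m | inj₁ dA with dominates-end dA
  ...   | _ , _ , ε , q =
    ⊥-elim (alice≢free (trans (sym q) (trans (↦-other r alice (≢-sym (e≢end ε m))) (unclaimed-end unc ε))))
  bob-threat {r} (move x rx k) r↾ unc dB | end ε | inj₂ (_ , replies) =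
    ⊥-elim (proj₁ (replies _ (partner-free alice unc ε))
      (bob-claims-end (r [ x ↦ alice ]) (Dominates-mono H dB (↾-keeps-claimed alice r↾ rx bob≢free))
                      (ends-swap ε)))
  bob-threat {r} (move x rx k) r↾ unc dB | inner m | inj₂ (_ , replies) =
    ⊥-elim (proj₁ (replies u (trans (↦-other r alice (≢-sym (e≢u m))) (u-free unc)))
      (bob-claims-end (r [ x ↦ alice ]) (Dominates-mono H dB (↾-keeps-claimed alice r↾ rx bob≢free)) u-v))

  bob-H-undominated : ∀ {r r'} → AliceWinsFrom F r → ¬ Dominates F r bob → r ↾ r' → Paired r →
                      ¬ Dominates H r' alice → ¬ Dominates H r' bob
  bob-H-undominated w nB r↾ (unclaimed unc) nA dB = nA (bob-threat w r↾ unc dB)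
  bob-H-undominated w nB r↾ (split ε _ ry)  nA dB = nB (extend-dominates r↾ dB (ends-swap ε) ry)

  full-if-edge-claimed : ∀ (s : Position N) → (∀ i → s (e i) ≢ free) → s u ≢ free → s v ≢ free →
                         ∀ z → s z ≢ free
  full-if-edge-claimed s rest su sv z with view z
  ... | end u-v = su
  ... | end v-u = sv
  ... | inner i = rest i

  -- With the rest of the board full, Bob answers u, Alice must take v, and the
  -- game ends in a draw; so a free cell of the rest remains.
  free-cell-remains : ∀ {t t'} → BobLoses F t → t ↾ t' → Paired t → ¬ Dominates H t' alice →
                      ∃[ j ] t' j ≡ free
  free-cell-remains {t} {t'} ((w , tw) , replies) t↾ pt nA with any? (λ j → t' j ≟ᶜ free)
  ... | yes found = found
  ... | no none   = edge-played (view w) tw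
    where
      rest-claimed : ∀ {s} → s ↾ t' → ∀ i → s (e i) ≢ free
      rest-claimed s↾ i si = none (i , trans (sym (at s↾ i)) si)

      r = t [ u ↦ bob ]
      r↾ : r ↾ t'
      r↾ = ↾-claim-end bob u-v t↾

      drawn : ¬ (Dominates F (r [ v ↦ alice ]) alice ⊎ BobLoses F (r [ v ↦ alice ]))
      drawn (inj₁ d)              = nA (restrict-dominates (↾-claim-end alice v-u r↾) d)
      drawn (inj₂ ((z , fz) , _)) =
        full-if-edge-claimed (r [ v ↦ alice ]) (rest-claimed (↾-claim-end alice v-u r↾))
          (λ q → bob≢free (trans (sym (claim-partner-keeps t bob alice u-v)) q))
          (λ q → alice≢free (trans (sym (↦-self r v alice)) q)) z fz

      edge-played : ∀ {w} → View w → t w ≡ free → ∃[ j ] t' j ≡ free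
      edge-played (inner i) ti = ⊥-elim (rest-claimed t↾ i ti)
      edge-played (end ε) tx with proj₂ (replies u (u-free (paired-free-end pt ε tx)))
      ... | move y ry k with view y
      ...   | inner i = ⊥-elim (rest-claimed r↾ i ry)
      ...   | end ε′ with ends-cover u-v ε′
      ...     | inj₁ refl = ⊥-elim (bob≢free (trans (sym (↦-self t u bob)) ry))
      ...     | inj₂ refl = ⊥-elim (drawn k)

  lift-win : ∀ {s s'} → AliceWinsFrom H s' → s ↾ s' → Paired s → ¬ Dominates H s' bob →
             AliceWinsFrom F s
  lift-win {s} {s'} (move i s'i k) s↾ ps nB = move (e i) (trans (at s↾ i) s'i) (lift-answer k)
    where
      t = s [ e i ↦ alice ]
      t' = s' [ i ↦ alice ]
      t↾ : t ↾ t'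
      t↾ = ↾-claim s↾ i alice
      nB' : ¬ Dominates H t' bob
      nB' d = nB (Dominates-mono H d (λ j t'j → ↦-reflects s' {i} {j} t'j (≢-sym alice≢bob)))

      lift-answer : Dominates H t' alice ⊎ BobLoses H t' → Dominates F t alice ⊎ BobLoses F t
      lift-answer (inj₁ dA) with paired-claim ps i alice
      ... | unclaimed unc = inj₂ (unclaimed-edge-wins t↾ unc dA nB')
      ... | split ε tx _  = inj₁ (extend-dominates t↾ dA ε tx)
      lift-answer (inj₂ ((j₀ , t'j₀) , replies)) =
        inj₂ ((e j₀ , trans (at t↾ j₀) t'j₀) , paired-replies t↾ (paired-claim ps i alice))
        where
          inner-reply : ∀ {r} → r ↾ t' → Paired r → ∀ j → r (e j) ≡ free → ReplyLoses F r (e j)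
          inner-reply r↾ pr j rj =
            (λ d → proj₁ (replies j t'j) (restrict-dominates (↾-claim r↾ j bob) d)) ,
            lift-win (proj₂ (replies j t'j)) (↾-claim r↾ j bob) (paired-claim pr j bob) (proj₁ (replies j t'j))
            where
              t'j = trans (sym (at r↾ j)) rj

          split-replies : ∀ {r x y} → r ↾ t' → Ends x y → r x ≡ alice → r y ≡ bob →
                          ∀ w → r w ≡ free → ReplyLoses F r w
          split-replies {r} r↾ ε rx ry w rw with view w
          ... | end ε′  = ⊥-elim (split-end-claimed r ε rx ry ε′ rw)
          ... | inner j = inner-reply r↾ (split ε rx ry) j rw

          paired-replies : ∀ {r} → r ↾ t' → Paired r → ∀ w → r w ≡ free → ReplyLoses F r w
          paired-replies r↾ (split ε rx ry) = split-replies r↾ ε rx ry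
          paired-replies {r} r↾ (unclaimed unc) w rw with view w
          ... | inner j = inner-reply r↾ (unclaimed unc) j rw
          ... | end {y = y} ε =
            (λ d → nB' (dominating-reply⇒dominated r↾ unc rw d)) ,
            move y (partner-free bob unc ε)
              (inj₂ ((e j₀ , trans (at r″↾ j₀) t'j₀) ,
                     split-replies r″↾ (ends-swap ε) (↦-self (r [ w ↦ bob ]) y alice)
                                       (claim-partner-keeps r bob alice ε)))
            where
              r″↾ = ↾-claim-end alice (ends-swap ε) (↾-claim-end bob ε r↾)

  restrict-win : ∀ {s s'} → AliceWinsFrom F s → s ↾ s' → Paired s → ¬ Dominates H s' alice →
                 AliceWinsFrom H s'
  restrict-win {s} {s'} (move x sx k) s↾ ps nA with view x | k
  ... | end ε | inj₁ dA = ⊥-elim (nA (restrict-dominates (↾-claim-end alice ε s↾) dA))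
  ... | end {y = y} ε | inj₂ (_ , replies) =
    restrict-win (proj₂ (replies y (partner-free alice (paired-free-end ps ε sx) ε)))
                 (↾-claim-end bob (ends-swap ε) (↾-claim-end alice ε s↾))
                 (split ε (claim-partner-keeps s alice bob ε) (↦-self (s [ x ↦ alice ]) y bob)) nA
  ... | inner i | _ with dominates? H (s' [ i ↦ alice ]) alice
  ...   | yes dA = move i (trans (sym (at s↾ i)) sx) (inj₁ dA)
  restrict-win {s} {s'} (move x sx k) s↾ ps nA | inner i | inj₁ d | no nA′ =
    ⊥-elim (nA′ (restrict-dominates (↾-claim s↾ i alice) d))
  restrict-win {s} {s'} (move x sx k) s↾ ps nA | inner i | inj₂ (ex , replies) | no nA′ =
    move i (trans (sym (at s↾ i)) sx) (inj₂ (free-cell-remains (ex , replies) t↾ pt nA′ , reply))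
    where
      t' = s' [ i ↦ alice ]
      t↾ = ↾-claim s↾ i alice
      pt = paired-claim ps i alice

      reply : ∀ j → t' j ≡ free → ReplyLoses H t' j
      reply j t'j =
        bob-H-undominated (proj₂ (replies (e j) tj)) (proj₁ (replies (e j) tj)) r↾ pr nA″ ,
        restrict-win (proj₂ (replies (e j) tj)) r↾ pr nA″
        where
          tj = trans (at t↾ j) t'j
          r↾ = ↾-claim t↾ j bob
          pr = paired-claim pt j bob
          nA″ : ¬ Dominates H (t' [ j ↦ bob ]) alice
          nA″ d = nA′ (Dominates-mono H d (λ m q → ↦-reflects t' {j} {m} q alice≢bob))

  start↾ : start ↾ start
  start↾ = mk↾ λ _ → refl

  start-paired : Paired start
  start-paired = unclaimed (both-free refl refl)

  restrict-outcomeA : OutcomeA F → OutcomeA H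
  restrict-outcomeA (inj₁ d) with dominates-end d
  ... | _ , _ , _ , ()
  restrict-outcomeA (inj₂ w) with dominates? H start alice
  ... | yes dA = inj₁ dA
  ... | no nA  = inj₂ (restrict-win w start↾ start-paired nA)

  lift-outcomeA : OutcomeA H → OutcomeA F
  lift-outcomeA (inj₁ dA)             = inj₂ (claim-end-wins start↾ dA u-v refl)
  lift-outcomeA (inj₂ w@(move i _ _)) = inj₂ (lift-win w start↾ start-paired nB)
    where
      nB : ¬ Dominates H start bob
      nB d with d i
      ... | inj₁ ()
      ... | inj₂ (_ , () , _)

lemma16 : (n : ℕ) (F : Graph (suc (suc n))) → IsForest F →
          (u v : Fin (suc (suc n))) (iso : IsolatedEdge F u v) →
          OutcomeA F ⇔ OutcomeA (delete2 F u v (adj⇒≢ F (proj₁ iso)))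
lemma16 n F _ u v iso = mk⇔ restrict-outcomeA lift-outcomeA
  where open IsolatedEdgeGame n F u v iso
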